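{- If $f:\mathcal{S}_n\to\mathcal{P}(B)$ is a $(1,2)$-sensitive bucketing function with $B$ finite, then $|B|\ge n|\Sigma|^{n-1}$.
   Context: $\Sigma$ is a finite alphabet with $|\Sigma|>1$, $n\ge1$, and $\mathcal{S}_n=\Sigma^n$ with the edit (Levenshtein) distance $\mathrm{edit}$. A bucketing function with bucket set $B$ is a map $f:\mathcal{S}_n\to\mathcal{P}(B)$; it is $(d_1,d_2)$-sensitive if for all $s,t\in\mathcal{S}_n$: $\mathrm{edit}(s,t)\le d_1\Rightarrow f(s)\cap f(t)\neq\emptyset$ and $\mathrm{edit}(s,t)\ge d_2\Rightarrow f(s)\cap f(t)=\emptyset$. -}

module Defs where

open import Data.Nat using (ℕ; zero; suc; _+_; _⊔_; _⊓_; _≤_; _≥_)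
open import Data.Fin using (Fin)
open import Data.Fin.Properties using (_≟_)
open import Data.Fin.Subset using (Subset; _∈_)
open import Data.List using (List; []; _∷_; length)
open import Data.Vec using (Vec; toList)
open import Data.Product using (∃; _×_)
open import Relation.Nullary using (¬_; yes; no)

editL : {k : ℕ} → List (Fin k) → List (Fin k) → ℕ
editL [] ys = length ys
editL (x ∷ xs) [] = length (x ∷ xs)
editL (x ∷ xs) (y ∷ ys) =
  suc (editL xs (y ∷ ys)) ⊓ (suc (editL (x ∷ xs) ys) ⊓ (editL xs ys + cost))
  where
    cost : ℕ
    cost with x ≟ y
    ... | yes _ = 0
    ... | no _ = 1

edit : {k n : ℕ} → Vec (Fin k) n → Vec (Fin k) n → ℕ
edit s t = editL (toList s) (toList t)

-- bucketing function S_n → P(B), with B = Fin m; is (d₁,d₂)-sensitive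
Sensitive : {k n m : ℕ} → (d₁ d₂ : ℕ) → (Vec (Fin k) n → Subset m) → Set
Sensitive {k} {n} {m} d₁ d₂ f =
  ((s t : Vec (Fin k) n) → edit s t ≤ d₁ → ∃ λ (b : Fin m) → b ∈ f s × b ∈ f t)
  × ((s t : Vec (Fin k) n) → edit s t ≥ d₂ → ¬ (∃ λ (b : Fin m) → b ∈ f s × b ∈ f t))

{-# OPTIONS --safe #-}
-- Fix two distinct letters a and b. A line is a position i together with the
-- n - 1 letters outside it; its a-point and b-point are at edit distance 1, so
-- some bucket contains both. Between strings of equal length, edit distance at
-- most 1 means Hamming distance at most 1, and two strings sharing a bucket are
-- at edit distance at most 1. If two lines chose the same bucket, their four
-- points would be pairwise at Hamming distance at most 1, which forces the
-- lines to coincide. So lines inject into buckets, and there are n |Σ|^(n-1)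
-- lines.
module Submission where

open import Defs
open import Data.Nat using (ℕ; zero; suc; _+_; _*_; _^_; _⊓_; _≤_; _∸_; z≤n; s≤s; _≤?_)
open import Data.Nat.Properties
  using (⊓-sel; m⊓n≤n; ≤-trans; ≤-reflexive; ≰⇒>; n≤0⇒n≡0; m+n≡0⇒m≡0; m+n≡0⇒n≡0; +-identityʳ; +-cancelʳ-≤; 1+n≢n)
open import Data.Fin using (Fin; zero; suc; remQuot; quotient; remainder; combine)
open import Data.Fin.Properties using (_≟_; combine-remQuot; injective⇒≤)
open import Data.Fin.Subset using (Subset; _∈_)
open import Data.Vec using (Vec; []; _∷_; toList; insertAt)
open import Data.Vec.Properties using (∷-injective; length-toList; toList-injective)
open import Data.Vec.Relation.Binary.Equality.Cast using (cast-is-id)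
open import Data.List using (List; []; _∷_; length)
open import Data.Product using (_×_; _,_; proj₁; proj₂; ∃; uncurry)
open import Data.Sum using (_⊎_; inj₁; inj₂)
open import Data.Empty using (⊥-elim)
open import Relation.Nullary using (¬_; Dec; yes; no)
open import Relation.Binary.PropositionalEquality
open import Function using (_∘_)
open import Function.Definitions using (Injective)

private
  variable
    A : Set
    k n : ℕ

data Hamming≤1 {A : Set} : Vec A n → Vec A n → Set where
  []    : Hamming≤1 [] []
  here  : (x y : A) (xs : Vec A n) → Hamming≤1 (x ∷ xs) (y ∷ xs)
  there : (x : A) {xs ys : Vec A n} → Hamming≤1 xs ys → Hamming≤1 (x ∷ xs) (x ∷ ys)

Hamming≤1-refl : (xs : Vec A n) → Hamming≤1 xs xs
Hamming≤1-refl []       = []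
Hamming≤1-refl (x ∷ xs) = here x x xs

Hamming≤1-sym : {xs ys : Vec A n} → Hamming≤1 xs ys → Hamming≤1 ys xs
Hamming≤1-sym []            = []
Hamming≤1-sym (here x y xs) = here y x xs
Hamming≤1-sym (there x p)   = there x (Hamming≤1-sym p)

Hamming≤1-tail : {x y : A} {xs ys : Vec A n} → Hamming≤1 (x ∷ xs) (y ∷ ys) → Hamming≤1 xs ys
Hamming≤1-tail (here _ _ xs) = Hamming≤1-refl xs
Hamming≤1-tail (there _ p)   = p

Hamming≤1-∷-≢ : {x y : A} {xs ys : Vec A n} → x ≢ y → Hamming≤1 (x ∷ xs) (y ∷ ys) → xs ≡ ys
Hamming≤1-∷-≢ x≢y (here _ _ _) = refl
Hamming≤1-∷-≢ x≢y (there _ _)  = ⊥-elim (x≢y refl)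

insertAt-Hamming≤1 : (w : Vec A n) (i : Fin (suc n)) (a b : A) →
                     Hamming≤1 (insertAt w i a) (insertAt w i b)
insertAt-Hamming≤1 w       zero    a b = here a b w
insertAt-Hamming≤1 (x ∷ w) (suc i) a b = there x (insertAt-Hamming≤1 w i a b)

insertAt-injective : (w : Vec A n) (i : Fin (suc n)) {a b : A} →
                     insertAt w i a ≡ insertAt w i b → a ≡ b
insertAt-injective w       zero    eq = proj₁ (∷-injective eq)
insertAt-injective (x ∷ w) (suc i) eq = insertAt-injective w i (proj₂ (∷-injective eq))

-- The line (i , w) consists of the strings insertAt w i c; Linked says that the
-- a- and b-points of two lines are pairwise at Hamming distance at most 1.
module Lines {A : Set} (_≟ᴬ_ : (x y : A) → Dec (x ≡ y)) {a b : A} (a≢b : a ≢ b) where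

  Linked : (i j : Fin (suc n)) (w w' : Vec A n) → Set
  Linked i j w w' =
    Hamming≤1 (insertAt w i a) (insertAt w' j a) × Hamming≤1 (insertAt w i a) (insertAt w' j b) ×
    Hamming≤1 (insertAt w i b) (insertAt w' j a) × Hamming≤1 (insertAt w i b) (insertAt w' j b)

  Linked-sym : (i j : Fin (suc n)) (w w' : Vec A n) → Linked i j w w' → Linked j i w' w
  Linked-sym _ _ _ _ (aa , ab , ba , bb) =
    Hamming≤1-sym aa , Hamming≤1-sym ba , Hamming≤1-sym ab , Hamming≤1-sym bb

  Linked-tail : {i j : Fin (suc n)} {x y : A} {w w' : Vec A n} →
                Linked (suc i) (suc j) (x ∷ w) (y ∷ w') → Linked i j w w'
  Linked-tail (aa , ab , ba , bb) =
    Hamming≤1-tail aa , Hamming≤1-tail ab , Hamming≤1-tail ba , Hamming≤1-tail bb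

  -- One of the heads a, b of the first line's points differs from y; the tail of
  -- that point then equals the tails of both points of the second line.
  ¬Linked-zero-suc : (j : Fin (suc n)) (w : Vec A (suc n)) (y : A) (w' : Vec A n) →
                     ¬ Linked zero (suc j) w (y ∷ w')
  ¬Linked-zero-suc j w y w' (aa , ab , ba , bb) with a ≟ᴬ y
  ... | no a≢y   = a≢b (insertAt-injective w' j
                     (trans (sym (Hamming≤1-∷-≢ a≢y aa)) (Hamming≤1-∷-≢ a≢y ab)))
  ... | yes refl = a≢b (insertAt-injective w' j
                     (trans (sym (Hamming≤1-∷-≢ b≢a ba)) (Hamming≤1-∷-≢ b≢a bb)))
    where
      b≢a : b ≢ a
      b≢a = a≢b ∘ sym

  Linked⇒≡ : (i j : Fin (suc n)) (w w' : Vec A n) → Linked i j w w' → i ≡ j × w ≡ w'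
  Linked⇒≡ zero    zero    w       w'       (_ , ab , _) = refl , Hamming≤1-∷-≢ a≢b ab
  Linked⇒≡ zero    (suc j) w       (y ∷ w') l = ⊥-elim (¬Linked-zero-suc j w y w' l)
  Linked⇒≡ (suc i) zero    (x ∷ w) w'       l =
    ⊥-elim (¬Linked-zero-suc i w' x w (Linked-sym (suc i) zero (x ∷ w) w' l))
  Linked⇒≡ (suc i) (suc j) (x ∷ w) (y ∷ w') l@(aa , _ , ba , _) with x ≟ᴬ y
  ... | yes refl = let i≡j , w≡w' = Linked⇒≡ i j w w' (Linked-tail l)
                   in cong suc i≡j , cong (x ∷_) w≡w'
  ... | no x≢y   = ⊥-elim (a≢b (insertAt-injective w i
                     (trans (Hamming≤1-∷-≢ x≢y aa) (sym (Hamming≤1-∷-≢ x≢y ba)))))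

mismatch : {P : Set} → Dec P → ℕ
mismatch (yes _) = 0
mismatch (no _)  = 1

editL-∷ : (x : Fin k) (xs : List (Fin k)) (y : Fin k) (ys : List (Fin k)) →
          editL (x ∷ xs) (y ∷ ys) ≡
          suc (editL xs (y ∷ ys)) ⊓ (suc (editL (x ∷ xs) ys) ⊓ (editL xs ys + mismatch (x ≟ y)))
editL-∷ x xs y ys with x ≟ y
... | yes _ = refl
... | no _  = refl

mismatch-refl : (x : Fin k) → mismatch (x ≟ x) ≡ 0
mismatch-refl x with x ≟ x
... | yes _  = refl
... | no x≢x = ⊥-elim (x≢x refl)

mismatch≡0 : {P : Set} (p? : Dec P) → mismatch p? ≡ 0 → P
mismatch≡0 (yes p) _ = p

mismatch≤1 : {P : Set} (p? : Dec P) → mismatch p? ≤ 1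
mismatch≤1 (yes _) = z≤n
mismatch≤1 (no _)  = s≤s z≤n

m⊓n≤o⇒m≤o⊎n≤o : ∀ m n {o} → m ⊓ n ≤ o → m ≤ o ⊎ n ≤ o
m⊓n≤o⇒m≤o⊎n≤o m n m⊓n≤o with ⊓-sel m n
... | inj₁ m⊓n≡m = inj₁ (subst (_≤ _) m⊓n≡m m⊓n≤o)
... | inj₂ m⊓n≡n = inj₂ (subst (_≤ _) m⊓n≡n m⊓n≤o)

editL-refl : (xs : List (Fin k)) → editL xs xs ≡ 0
editL-refl []       = refl
editL-refl (x ∷ xs) rewrite editL-∷ x xs x xs | editL-refl xs | mismatch-refl x = refl

editL≡0⇒≡ : (xs ys : List (Fin k)) → editL xs ys ≡ 0 → xs ≡ ys
editL≡0⇒≡ []       []       _ = refl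
editL≡0⇒≡ (x ∷ xs) (y ∷ ys) d≡0
  with m⊓n≤o⇒m≤o⊎n≤o _ _ (subst (_≤ 0) (editL-∷ x xs y ys) (≤-reflexive d≡0))
... | inj₁ ()
... | inj₂ rest≤0 with m⊓n≤o⇒m≤o⊎n≤o _ _ rest≤0
...   | inj₁ ()
...   | inj₂ sub≤0 =
  cong₂ _∷_ (mismatch≡0 (x ≟ y) (m+n≡0⇒n≡0 _ sub≡0)) (editL≡0⇒≡ xs ys (m+n≡0⇒m≡0 _ sub≡0))
  where
    sub≡0 : editL xs ys + mismatch (x ≟ y) ≡ 0
    sub≡0 = n≤0⇒n≡0 sub≤0

Hamming≤1⇒edit≤1 : {s t : Vec (Fin k) n} → Hamming≤1 s t → edit s t ≤ 1
Hamming≤1⇒edit≤1 [] = z≤n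
Hamming≤1⇒edit≤1 (here x y xs)
  rewrite editL-∷ x (toList xs) y (toList xs) | editL-refl (toList xs) =
  ≤-trans (m⊓n≤n _ _) (≤-trans (m⊓n≤n _ _) (mismatch≤1 (x ≟ y)))
Hamming≤1⇒edit≤1 (there x {xs} {ys} p)
  rewrite editL-∷ x (toList xs) x (toList ys) | mismatch-refl x
        | +-identityʳ (editL (toList xs) (toList ys)) =
  ≤-trans (m⊓n≤n _ _) (≤-trans (m⊓n≤n _ _) (Hamming≤1⇒edit≤1 p))

toList≢∷toList : (xs : Vec A n) (y : A) (ys : Vec A n) → toList xs ≢ y ∷ toList ys
toList≢∷toList xs y ys eq = 1+n≢n (begin
  suc _                     ≡⟨ cong suc (length-toList ys) ⟨
  length (y ∷ toList ys)    ≡⟨ cong length eq ⟨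
  length (toList xs)        ≡⟨ length-toList xs ⟩
  _                         ∎)
  where open ≡-Reasoning

toList-injective′ : (xs ys : Vec A n) → toList xs ≡ toList ys → xs ≡ ys
toList-injective′ xs ys eq = trans (sym (cast-is-id refl xs)) (toList-injective refl xs ys eq)

edit≤1⇒Hamming≤1 : (s t : Vec (Fin k) n) → edit s t ≤ 1 → Hamming≤1 s t
edit≤1⇒Hamming≤1 []       []       _ = []
edit≤1⇒Hamming≤1 (x ∷ xs) (y ∷ ys) d≤1
  with m⊓n≤o⇒m≤o⊎n≤o _ _ (subst (_≤ 1) (editL-∷ x (toList xs) y (toList ys)) d≤1)
... | inj₁ (s≤s del≤0) =
  ⊥-elim (toList≢∷toList xs y ys (editL≡0⇒≡ _ _ (n≤0⇒n≡0 del≤0)))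
... | inj₂ rest≤1 with m⊓n≤o⇒m≤o⊎n≤o _ _ rest≤1
...   | inj₁ (s≤s ins≤0) =
  ⊥-elim (toList≢∷toList ys x xs (sym (editL≡0⇒≡ _ _ (n≤0⇒n≡0 ins≤0))))
...   | inj₂ sub≤1 with x ≟ y
...     | yes refl = there x (edit≤1⇒Hamming≤1 xs ys (subst (_≤ 1) (+-identityʳ _) sub≤1))
...     | no _ with toList-injective′ xs ys (editL≡0⇒≡ _ _ (n≤0⇒n≡0 (+-cancelʳ-≤ 1 _ 0 sub≤1)))
...       | refl = here x y xs

shared⇒Hamming≤1 : {m : ℕ} {f : Vec (Fin k) n → Subset m} → Sensitive 1 2 f →
                   {s t : Vec (Fin k) n} {b : Fin m} → b ∈ f s → b ∈ f t → Hamming≤1 s t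
shared⇒Hamming≤1 (_ , far⇒disjoint) {s} {t} b∈fs b∈ft with edit s t ≤? 1
... | yes d≤1 = edit≤1⇒Hamming≤1 s t d≤1
... | no d≰1  = ⊥-elim (far⇒disjoint s t (≰⇒> d≰1) (_ , b∈fs , b∈ft))

remQuot-injective : ∀ {m} n → Injective _≡_ _≡_ (remQuot {m} n)
remQuot-injective {m} n {i} {j} eq = begin
  i                                 ≡⟨ combine-remQuot {m} n i ⟨
  uncurry combine (remQuot {m} n i) ≡⟨ cong (uncurry combine) eq ⟩
  uncurry combine (remQuot {m} n j) ≡⟨ combine-remQuot {m} n j ⟩
  j                                 ∎
  where open ≡-Reasoning

finToVec : ∀ n → Fin (k ^ n) → Vec (Fin k) n
finToVec     zero    _ = []
finToVec {k} (suc n) i = quotient (k ^ n) i ∷ finToVec n (remainder {k} (k ^ n) i)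

finToVec-injective : ∀ n → Injective _≡_ _≡_ (finToVec {k} n)
finToVec-injective     zero    {zero} {zero} _ = refl
finToVec-injective {k} (suc n) eq =
  let q≡q' , v≡v' = ∷-injective eq
  in remQuot-injective {k} (k ^ n) (cong₂ _,_ q≡q' (finToVec-injective n v≡v'))

lineOf : ∀ n → Fin (suc n * k ^ n) → Fin (suc n) × Vec (Fin k) n
lineOf {k} n i = quotient (k ^ n) i , finToVec n (remainder {suc n} (k ^ n) i)

lineOf-injective : ∀ n → Injective _≡_ _≡_ (lineOf {k} n)
lineOf-injective {k} n eq =
  remQuot-injective {suc n} (k ^ n)
    (cong₂ _,_ (cong proj₁ eq) (finToVec-injective n (cong proj₂ eq)))

lemma3 : (k n m : ℕ) → 2 ≤ k → 1 ≤ n → (f : Vec (Fin k) n → Subset m) →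
    Sensitive 1 2 f → n * k ^ (n ∸ 1) ≤ m
lemma3 (suc (suc k)) (suc n) m (s≤s (s≤s _)) (s≤s _) f sensitive@(close⇒shared , _) =
  injective⇒≤ {f = bucket ∘ lineOf n} (lineOf-injective n ∘ bucket-injective)
  where
    open Lines _≟_ {a = zero} {b = suc zero} (λ ())

    Line : Set
    Line = Fin (suc n) × Vec (Fin (suc (suc k))) n

    sharedBucket : ((i , w) : Line) →
                   ∃ λ b → b ∈ f (insertAt w i zero) × b ∈ f (insertAt w i (suc zero))
    sharedBucket (i , w) =
      close⇒shared _ _ (Hamming≤1⇒edit≤1 (insertAt-Hamming≤1 w i zero (suc zero)))

    bucket : Line → Fin m
    bucket = proj₁ ∘ sharedBucket

    close : {s t : Vec (Fin (suc (suc k))) (suc n)} {b : Fin m} → b ∈ f s → b ∈ f t → Hamming≤1 s t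
    close = shared⇒Hamming≤1 sensitive

    bucket-injective : Injective _≡_ _≡_ bucket
    bucket-injective {i , w} {j , w'} eq with sharedBucket (i , w) | sharedBucket (j , w') | eq
    ... | b , a∈ , b∈ | .b , a∈' , b∈' | refl
      with Linked⇒≡ i j w w' (close a∈ a∈' , close a∈ b∈' , close b∈ a∈' , close b∈ b∈')
    ... | refl , refl = refl
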